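{- Regard $\mathcal P_m$ as a polynomial function on the vector space $W=\Lambda^3 V$. Then $\mathcal P_m$ descends to a well-defined polynomial function on $W/W_0$, where $W_0\subset W$ is the subspace spanned by the vectors $(\mathrm Y_{ijk}-\mathrm Y_{ijl})-(\mathrm Y_{jkl}-\mathrm Y_{ikl})$ for all sets $\{i,j,k,l\}$ of four distinct elements of $\{1,\dots,m\}$.
   Context: Let $y_{ijk}$ ($i,j,k\in\{1,\dots,m\}$) be indeterminates, totally antisymmetric in their indices ($y_{ijk}=-y_{jik}=y_{jki}$, $y_{iij}=0$). Let $\Lambda=(\lambda_{ij})_{1\le i,j\le m}$ with $\lambda_{ij}=\sum_k y_{ijk}$. The Pfaffian-tree polynomial is $\mathcal P_m=(-1)^{p-1}\operatorname{Pf}(\Lambda^{(p)})$, where $\Lambda^{(p)}$ is $\Lambda$ with the $p$th row and column removed (independent of $p$; Pfaffian of odd-size matrix is $0$). Let $\mathcal V$ have basis $v_1,\dots,v_m$, identify $y_{ijk}=v_i\wedge v_j\wedge v_k\in\Lambda^3\mathcal V$, and let $V=\mathcal V^*$. Then the $y_{ijk}$ ($i<j<k$) form a basis of linear forms on $W=\Lambda^3V$, and $\mathcal P_m\in S^{(m-1)/2}(\Lambda^3\mathcal V)$ is a polynomial function of degree $(m-1)/2$ on $W$. $\{\mathrm Y_{ijk}\}$ is the dual basis of $W$: $\langle y_{ijk},\mathrm Y_{\alpha\beta\gamma}\rangle$ is the sign of the permutation sending $(i,j,k)$ to $(\alpha,\beta,\gamma)$ if $\{i,j,k\}=\{\alpha,\beta,\gamma\}$,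 and $0$ otherwise. "Descends" means $\mathcal P_m(w+w_0)=\mathcal P_m(w)$ for all $w\in W$, $w_0\in W_0$. -}

module Defs where

import Level
open import Algebra.Bundles using (CommutativeRing)
open import Data.Nat using (ℕ; zero; suc)
open import Data.Fin using (Fin; zero; suc; punchIn; toℕ)
open import Data.Fin.Properties using (_≟_)
open import Data.List using (List; []; _∷_)
open import Data.List.Relation.Unary.All using (All)
open import Data.Product using (_×_; _,_; Σ)
open import Data.Bool using (Bool; true; false; _∧_; _∨_; if_then_else_)
open import Relation.Nullary using (¬_)
open import Relation.Nullary.Decidable using (⌊_⌋)
open import Relation.Binary.PropositionalEquality using (_≡_)

module _ {c ℓ} (R : CommutativeRing c ℓ) where
  open CommutativeRing R using (Carrier; _≈_; _+_; _*_; -_; _-_; 0#; 1#)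

  ∑ : (n : ℕ) → (Fin n → Carrier) → Carrier
  ∑ zero    f = 0#
  ∑ (suc n) f = f zero + ∑ n (λ i → f (suc i))

  sgn : ℕ → Carrier
  sgn zero    = 1#
  sgn (suc n) = - sgn n

  -- Pfaffian of an n×n matrix (0 for odd n), by the standard expansion
  -- along the first row:  Pf(A) = Σ_{j≥2} (-1)^j a_{1j} Pf(A with rows/cols 1,j removed)
  -- (1-indexed j; here j is 0-indexed in Fin (suc k), column suc j).
  Pf : (n : ℕ) → (Fin n → Fin n → Carrier) → Carrier
  Pf zero          A = 1#
  Pf (suc zero)    A = 0#
  Pf (suc (suc k)) A =
    ∑ (suc k) (λ j → sgn (toℕ j) * A zero (suc j)
                      * Pf k (λ a b → A (suc (punchIn j a)) (suc (punchIn j b))))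

  -- An element of W = Λ³V, given by its coordinates w ↦ y_{ijk}(w) for all i j k
  Coord : ℕ → Set c
  Coord m = Fin m → Fin m → Fin m → Carrier

  IsAlt : {m : ℕ} → Coord m → Set ℓ
  IsAlt {m} w = (∀ i j k → w i j k ≈ - w j i k)
              × (∀ i j k → w i j k ≈ w j k i)
              × (∀ i k → w i i k ≈ 0#)

  _⊕_ : {m : ℕ} → Coord m → Coord m → Coord m
  (v ⊕ w) i j k = v i j k + w i j k

  Λmat : {m : ℕ} → Coord m → Fin m → Fin m → Carrier
  Λmat {m} w i j = ∑ m (λ k → w i j k)

  -- 𝒫_m for m = suc n, computed with the p-th row/column removed:
  -- (-1)^{p-1} Pf(Λ^{(p)})  (p is 0-indexed here, so the sign is (-1)^{toℕ p})
  𝒫 : (n : ℕ) → Fin (suc n) → Coord (suc n) → Carrier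
  𝒫 n p w = sgn (toℕ p) * Pf n (λ i j → Λmat w (punchIn p i) (punchIn p j))

  -- ⟨y_{abc}, Y_{αβγ}⟩ for distinct α β γ: sign of the permutation taking
  -- (a,b,c) to (α,β,γ) if {a,b,c} = {α,β,γ}, and 0 otherwise
  eq3 : {m : ℕ} → Fin m → Fin m → Fin m → Fin m → Fin m → Fin m → Bool
  eq3 a b c x y z = ⌊ a ≟ x ⌋ ∧ ⌊ b ≟ y ⌋ ∧ ⌊ c ≟ z ⌋

  pairing : {m : ℕ} → (a b c α β γ : Fin m) → Carrier
  pairing a b c α β γ =
    if eq3 a b c α β γ ∨ eq3 a b c β γ α ∨ eq3 a b c γ α β then 1#
    else (if eq3 a b c β α γ ∨ eq3 a b c α γ β ∨ eq3 a b c γ β α then - 1# else 0#)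

  Yv : {m : ℕ} → Fin m → Fin m → Fin m → Coord m
  Yv α β γ a b c = pairing a b c α β γ

  Zv : {m : ℕ} → Fin m → Fin m → Fin m → Fin m → Coord m
  Zv i j k l a b c = (Yv i j k a b c - Yv i j l a b c) - (Yv j k l a b c - Yv i k l a b c)

  Distinct4 : {m : ℕ} → Fin m → Fin m → Fin m → Fin m → Set
  Distinct4 i j k l = ¬ i ≡ j × ¬ i ≡ k × ¬ i ≡ l × ¬ j ≡ k × ¬ j ≡ l × ¬ k ≡ l

  Gen : ℕ → Set c
  Gen m = Carrier × Fin m × Fin m × Fin m × Fin m

  GenOK : {m : ℕ} → Gen m → Set
  GenOK (_ , i , j , k , l) = Distinct4 i j k l

  comb : {m : ℕ} → List (Gen m) → Coord m
  comb []                          a b c = 0#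
  comb ((r , i , j , k , l) ∷ L) a b c = r * Zv i j k l a b c + comb L a b c

  InW₀ : {m : ℕ} → Coord m → Set (c Level.⊔ ℓ)
  InW₀ {m} v = Σ (List (Gen m)) (λ L → All GenOK L × (∀ a b c → v a b c ≈ comb L a b c))

-- 𝒫 depends on w only through the matrix Λ(w) = (Σ_c w a b c), which is linear in w, so it
-- suffices that Λ kills every generator Z_ijkl of W₀.
-- Λ(Y_αβγ) is the boundary e_αβ + e_βγ + e_γα of the triangle αβγ, and Λ(Z_ijkl) is the
-- difference of the boundaries of the two triangulations {ijk, ikl} and {jkl, ijl} of the
-- quadrilateral ijkl; both equal the boundary ij + jk + kl + li of the quadrilateral.
module Submission where

open import Defs
open import Algebra.Bundles using (CommutativeRing)
open import Data.Nat using (ℕ; zero; suc)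
open import Data.Fin as Fin using (Fin; punchIn)
open import Data.Bool using (Bool; true; false; T; _∧_; _∨_; if_then_else_)
open import Data.Bool.Properties using (∧-identityʳ; ∧-zeroʳ; ∨-identityʳ; T-∧)
open import Data.Empty using (⊥; ⊥-elim)
open import Data.Fin.Properties using (_≟_)
open import Data.List using (List; []; _∷_)
open import Data.List.Relation.Unary.All using (All; []; _∷_)
open import Data.Product using (_,_; proj₁)
open import Function.Bundles using (Equivalence)
open import Relation.Nullary using (yes; no)
open import Relation.Nullary.Decidable using (⌊_⌋; toWitness)
open import Relation.Binary.PropositionalEquality as ≡ using (_≡_; _≢_)

⌊suc≟suc⌋ : ∀ {n} (i j : Fin n) → ⌊ Fin.suc i ≟ Fin.suc j ⌋ ≡ ⌊ i ≟ j ⌋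
⌊suc≟suc⌋ i j with i ≟ j
... | yes _ = ≡.refl
... | no _  = ≡.refl

x∧y∧true≡x∧y : ∀ x y → x ∧ y ∧ true ≡ x ∧ y
x∧y∧true≡x∧y x y = ≡.cong (x ∧_) (∧-identityʳ y)

x∧y∧false≡false : ∀ x y → x ∧ y ∧ false ≡ false
x∧y∧false≡false x y = ≡.trans (≡.cong (x ∧_) (∧-zeroʳ y)) (∧-zeroʳ x)

data Position : Bool → Bool → Bool → Set where
  first  : Position true false false
  second : Position false true false
  third  : Position false false true
  other  : Position false false false

position : ∀ {m} {α β γ : Fin m} → α ≢ β → α ≢ γ → β ≢ γ →
           ∀ c → Position ⌊ c ≟ α ⌋ ⌊ c ≟ β ⌋ ⌊ c ≟ γ ⌋
position {α = α} {β} {γ} α≢β α≢γ β≢γ c with c ≟ α | c ≟ β | c ≟ γ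
... | yes c≡α | yes c≡β | _       = ⊥-elim (α≢β (≡.trans (≡.sym c≡α) c≡β))
... | yes c≡α | no _    | yes c≡γ = ⊥-elim (α≢γ (≡.trans (≡.sym c≡α) c≡γ))
... | yes _   | no _    | no _    = first
... | no _    | yes c≡β | yes c≡γ = ⊥-elim (β≢γ (≡.trans (≡.sym c≡β) c≡γ))
... | no _    | yes _   | no _    = second
... | no _    | no _    | yes _   = third
... | no _    | no _    | no _    = other

module _ {c ℓ} (R : CommutativeRing c ℓ) where
  open CommutativeRing R hiding (zero)
  open import Algebra.Properties.AbelianGroup +-abelianGroup
    using (ε⁻¹≈ε; x≈y⇒x∙y⁻¹≈ε; ⁻¹-anti-homo‿-; ⁻¹-∙-comm)
  open import Algebra.Properties.Semiring.Sum semiring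
    using (sum; sum-cong-≋; ∑-distrib-+; *-distribˡ-sum; sum-replicate-zero)
  open import Algebra.Solver.CommutativeMonoid +-commutativeMonoid
    using (solve; _⊜_) renaming (_⊕_ to _⊞_)
  open import Relation.Binary.Reasoning.Setoid setoid

  ∑≡sum : ∀ n (f : Fin n → Carrier) → ∑ R n f ≡ sum f
  ∑≡sum zero    f = ≡.refl
  ∑≡sum (suc n) f = ≡.cong (f Fin.zero +_) (∑≡sum n (λ i → f (Fin.suc i)))

  ∑-cong : ∀ n {f g : Fin n → Carrier} → (∀ i → f i ≈ g i) → ∑ R n f ≈ ∑ R n g
  ∑-cong n {f} {g} f≈g = begin
    ∑ R n f ≡⟨ ∑≡sum n f ⟩
    sum f   ≈⟨ sum-cong-≋ f≈g ⟩
    sum g   ≡⟨ ∑≡sum n g ⟨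
    ∑ R n g ∎

  sum-neg : ∀ {n} (f : Fin n → Carrier) → sum (λ i → - f i) ≈ - sum f
  sum-neg {zero}  f = sym ε⁻¹≈ε
  sum-neg {suc n} f = trans (+-congˡ (sum-neg (λ i → f (Fin.suc i)))) (⁻¹-∙-comm _ _)

  sum-sub : ∀ {n} (f g : Fin n → Carrier) → sum (λ i → f i - g i) ≈ sum f - sum g
  sum-sub f g = trans (∑-distrib-+ f (λ i → - g i)) (+-congˡ (sum-neg g))

  single : ∀ {n} → Fin n → Carrier → Fin n → Carrier
  single z x i = if ⌊ i ≟ z ⌋ then x else 0#

  sum-single : ∀ {n} (z : Fin n) (x : Carrier) → sum (single z x) ≈ x
  sum-single {suc n} Fin.zero    x = trans (+-congˡ (sum-replicate-zero n)) (+-identityʳ x)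
  sum-single {suc n} (Fin.suc z) x = begin
    0# + sum (λ i → single (Fin.suc z) x (Fin.suc i))
      ≈⟨ +-identityˡ _ ⟩
    sum (λ i → single (Fin.suc z) x (Fin.suc i))
      ≈⟨ sum-cong-≋ (λ i → reflexive (≡.cong (λ b → if b then x else 0#) (⌊suc≟suc⌋ i z))) ⟩
    sum (single z x)
      ≈⟨ sum-single z x ⟩
    x ∎

  [x-y]-[z-w]≈0 : ∀ {x y z w} → x + w ≈ z + y → (x - y) - (z - w) ≈ 0#
  [x-y]-[z-w]≈0 {x} {y} {z} {w} x+w≈z+y = begin
    (x - y) - (z - w)     ≈⟨ +-congˡ (⁻¹-anti-homo‿- z w) ⟩
    (x - y) + (w - z)     ≈⟨ solve 4 (λ x y′ w z′ → (x ⊞ y′) ⊞ (w ⊞ z′) ⊜ (x ⊞ w) ⊞ (z′ ⊞ y′))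
                                   refl x (- y) w (- z) ⟩
    (x + w) + (- z + - y) ≈⟨ +-congˡ (⁻¹-∙-comm z y) ⟩
    (x + w) - (z + y)     ≈⟨ x≈y⇒x∙y⁻¹≈ε x+w≈z+y ⟩
    0#                    ∎

  ∂ : ∀ {A : Set} → (A → A → Carrier) → A → A → A → Carrier
  ∂ s x y z = s x y + (s y z + s z x)

  ∂-triangulations : ∀ {A : Set} (s : A → A → Carrier) {i j k l} →
    s i k + s k i ≈ 0# → s j l + s l j ≈ 0# →
    ∂ s i j k + ∂ s i k l ≈ ∂ s j k l + ∂ s i j l
  ∂-triangulations s {i} {j} {k} {l} ik+ki≈0 jl+lj≈0 = begin
    ∂ s i j k + ∂ s i k l
      ≈⟨ solve 6 (λ ij jk ki ik kl li →
                   (ij ⊞ (jk ⊞ ki)) ⊞ (ik ⊞ (kl ⊞ li)) ⊜ (ij ⊞ (jk ⊞ (kl ⊞ li))) ⊞ (ik ⊞ ki))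
                 refl (s i j) (s j k) (s k i) (s i k) (s k l) (s l i) ⟩
    square + (s i k + s k i) ≈⟨ +-congˡ ik+ki≈0 ⟩
    square + 0#              ≈⟨ +-congˡ jl+lj≈0 ⟨
    square + (s j l + s l j)
      ≈⟨ solve 6 (λ ij jk kl li jl lj →
                   (ij ⊞ (jk ⊞ (kl ⊞ li))) ⊞ (jl ⊞ lj) ⊜ (jk ⊞ (kl ⊞ lj)) ⊞ (ij ⊞ (jl ⊞ li)))
                 refl (s i j) (s j k) (s k l) (s l i) (s j l) (s l j) ⟩
    ∂ s j k l + ∂ s i j l ∎
    where
    square = s i j + (s j k + (s k l + s l i))

  sign : Bool → Bool → Carrier
  sign p q = if p then 1# else if q then - 1# else 0#

  sign-antisym : ∀ p q → (T p → T q → ⊥) → sign p q + sign q p ≈ 0#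
  sign-antisym true  true  excl = ⊥-elim (excl _ _)
  sign-antisym true  false _    = -‿inverseʳ 1#
  sign-antisym false true  _    = -‿inverseˡ 1#
  sign-antisym false false _    = +-identityˡ 0#

  -- With Aₓ, Bₓ, Cₓ standing for ⌊ a ≟ x ⌋, ⌊ b ≟ x ⌋, ⌊ c ≟ x ⌋ (x = α, β, γ in turn),
  -- the left-hand side is pairing R a b c α β γ unfolded.
  sign-expand : ∀ {C₁ C₂ C₃} → Position C₁ C₂ C₃ → ∀ A₁ A₂ A₃ B₁ B₂ B₃ →
    sign ((A₁ ∧ B₂ ∧ C₃) ∨ (A₂ ∧ B₃ ∧ C₁) ∨ (A₃ ∧ B₁ ∧ C₂))
         ((A₂ ∧ B₁ ∧ C₃) ∨ (A₁ ∧ B₃ ∧ C₂) ∨ (A₃ ∧ B₂ ∧ C₁))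
    ≈ (if C₃ then sign (A₁ ∧ B₂) (A₂ ∧ B₁) else 0#)
      + ((if C₁ then sign (A₂ ∧ B₃) (A₃ ∧ B₂) else 0#)
         + (if C₂ then sign (A₃ ∧ B₁) (A₁ ∧ B₃) else 0#))
  sign-expand first A₁ A₂ A₃ B₁ B₂ B₃
    rewrite x∧y∧false≡false A₁ B₂ | x∧y∧true≡x∧y A₂ B₃ | x∧y∧false≡false A₃ B₁
          | x∧y∧false≡false A₂ B₁ | x∧y∧false≡false A₁ B₃ | x∧y∧true≡x∧y A₃ B₂
          | ∨-identityʳ (A₂ ∧ B₃)
    = sym (trans (+-identityˡ _) (+-identityʳ _))
  sign-expand second A₁ A₂ A₃ B₁ B₂ B₃
    rewrite x∧y∧false≡false A₁ B₂ | x∧y∧false≡false A₂ B₃ | x∧y∧true≡x∧y A₃ B₁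
          | x∧y∧false≡false A₂ B₁ | x∧y∧true≡x∧y A₁ B₃ | x∧y∧false≡false A₃ B₂
          | ∨-identityʳ (A₁ ∧ B₃)
    = sym (trans (+-identityˡ _) (+-identityˡ _))
  sign-expand third A₁ A₂ A₃ B₁ B₂ B₃
    rewrite x∧y∧true≡x∧y A₁ B₂ | x∧y∧false≡false A₂ B₃ | x∧y∧false≡false A₃ B₁
          | x∧y∧true≡x∧y A₂ B₁ | x∧y∧false≡false A₁ B₃ | x∧y∧false≡false A₃ B₂
          | ∨-identityʳ (A₁ ∧ B₂) | ∨-identityʳ (A₂ ∧ B₁)
    = sym (trans (+-congˡ (+-identityˡ 0#)) (+-identityʳ _))
  sign-expand other A₁ A₂ A₃ B₁ B₂ B₃
    rewrite x∧y∧false≡false A₁ B₂ | x∧y∧false≡false A₂ B₃ | x∧y∧false≡false A₃ B₁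
          | x∧y∧false≡false A₂ B₁ | x∧y∧false≡false A₁ B₃ | x∧y∧false≡false A₃ B₂
    = sym (trans (+-identityˡ _) (+-identityˡ 0#))

  pairing₂ : ∀ {m} → (a b x y : Fin m) → Carrier
  pairing₂ a b x y = sign (⌊ a ≟ x ⌋ ∧ ⌊ b ≟ y ⌋) (⌊ a ≟ y ⌋ ∧ ⌊ b ≟ x ⌋)

  pairing₂-antisym : ∀ {m} (a b : Fin m) {x y} → x ≢ y →
                     pairing₂ a b x y + pairing₂ a b y x ≈ 0#
  pairing₂-antisym a b x≢y =
    sign-antisym (⌊ a ≟ _ ⌋ ∧ ⌊ b ≟ _ ⌋) (⌊ a ≟ _ ⌋ ∧ ⌊ b ≟ _ ⌋)
      (λ a≡x a≡y → x≢y (≡.trans (≡.sym (first-index a≡x)) (first-index a≡y)))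
    where
    first-index : ∀ {z w} → T (⌊ a ≟ z ⌋ ∧ ⌊ b ≟ w ⌋) → a ≡ z
    first-index {z} {w} t = toWitness {a? = a ≟ z} (proj₁ (Equivalence.to (T-∧ {⌊ a ≟ z ⌋} {⌊ b ≟ w ⌋}) t))

  pairing-expand : ∀ {m} {α β γ : Fin m} → α ≢ β → α ≢ γ → β ≢ γ → ∀ a b c →
    pairing R a b c α β γ
    ≈ single γ (pairing₂ a b α β) c + (single α (pairing₂ a b β γ) c + single β (pairing₂ a b γ α) c)
  pairing-expand {α = α} {β} {γ} α≢β α≢γ β≢γ a b c =
    sign-expand (position α≢β α≢γ β≢γ c)
      ⌊ a ≟ α ⌋ ⌊ a ≟ β ⌋ ⌊ a ≟ γ ⌋ ⌊ b ≟ α ⌋ ⌊ b ≟ β ⌋ ⌊ b ≟ γ ⌋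

  sum-Yv : ∀ {m} {α β γ : Fin m} → α ≢ β → α ≢ γ → β ≢ γ →
           ∀ a b → sum (Yv R α β γ a b) ≈ ∂ (pairing₂ a b) α β γ
  sum-Yv {α = α} {β} {γ} α≢β α≢γ β≢γ a b = begin
    sum (Yv R α β γ a b)
      ≈⟨ sum-cong-≋ (pairing-expand α≢β α≢γ β≢γ a b) ⟩
    sum (λ c → single γ (s α β) c + (single α (s β γ) c + single β (s γ α) c))
      ≈⟨ ∑-distrib-+ (single γ (s α β)) (λ c → single α (s β γ) c + single β (s γ α) c) ⟩
    sum (single γ (s α β)) + sum (λ c → single α (s β γ) c + single β (s γ α) c)
      ≈⟨ +-congˡ (∑-distrib-+ (single α (s β γ)) (single β (s γ α))) ⟩
    sum (single γ (s α β)) + (sum (single α (s β γ)) + sum (single β (s γ α)))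
      ≈⟨ +-cong (sum-single γ _) (+-cong (sum-single α _) (sum-single β _)) ⟩
    ∂ s α β γ ∎
    where
    s = pairing₂ a b

  sum-Zv : ∀ {m} {i j k l : Fin m} → Distinct4 R i j k l → ∀ a b → sum (Zv R i j k l a b) ≈ 0#
  sum-Zv {i = i} {j} {k} {l} (i≢j , i≢k , i≢l , j≢k , j≢l , k≢l) a b = begin
    sum (Zv R i j k l a b)
      ≈⟨ trans (sum-sub (λ c → Y i j k c - Y i j l c) (λ c → Y j k l c - Y i k l c))
               (+-cong (sum-sub (Y i j k) (Y i j l)) (-‿cong (sum-sub (Y j k l) (Y i k l)))) ⟩
    (sum (Y i j k) - sum (Y i j l)) - (sum (Y j k l) - sum (Y i k l))
      ≈⟨ +-cong (+-cong (sum-Yv i≢j i≢k j≢k a b) (-‿cong (sum-Yv i≢j i≢l j≢l a b)))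
                (-‿cong (+-cong (sum-Yv j≢k j≢l k≢l a b) (-‿cong (sum-Yv i≢k i≢l k≢l a b)))) ⟩
    (∂ s i j k - ∂ s i j l) - (∂ s j k l - ∂ s i k l)
      ≈⟨ [x-y]-[z-w]≈0 (∂-triangulations s (pairing₂-antisym a b i≢k) (pairing₂-antisym a b j≢l)) ⟩
    0# ∎
    where
    Y = λ x y z → Yv R x y z a b
    s = pairing₂ a b

  sum-comb : ∀ {m} (L : List (Gen R m)) → All (GenOK R) L → ∀ a b → sum (comb R L a b) ≈ 0#
  sum-comb {m} []                      []         a b = sum-replicate-zero m
  sum-comb {m} ((r , i , j , k , l) ∷ L) (ok ∷ oks) a b = begin
    sum (λ c → r * Zv R i j k l a b c + comb R L a b c)
      ≈⟨ ∑-distrib-+ (λ c → r * Zv R i j k l a b c) (comb R L a b) ⟩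
    sum (λ c → r * Zv R i j k l a b c) + sum (comb R L a b)
      ≈⟨ +-congʳ (*-distribˡ-sum r (Zv R i j k l a b)) ⟨
    r * sum (Zv R i j k l a b) + sum (comb R L a b)
      ≈⟨ +-cong (*-congˡ (sum-Zv ok a b)) (sum-comb L oks a b) ⟩
    r * 0# + 0#
      ≈⟨ trans (+-identityʳ _) (zeroʳ r) ⟩
    0# ∎

  Λmat-⊕-InW₀ : ∀ {m} (w w₀ : Coord R m) → InW₀ R w₀ → ∀ a b → Λmat R (_⊕_ R w w₀) a b ≈ Λmat R w a b
  Λmat-⊕-InW₀ {m} w w₀ (L , oks , w₀≈comb) a b = begin
    Λmat R (_⊕_ R w w₀) a b         ≡⟨ ∑≡sum m _ ⟩
    sum (λ c → w a b c + w₀ a b c) ≈⟨ ∑-distrib-+ (w a b) (w₀ a b) ⟩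
    sum (w a b) + sum (w₀ a b)      ≈⟨ +-congˡ (trans (sum-cong-≋ (w₀≈comb a b)) (sum-comb L oks a b)) ⟩
    sum (w a b) + 0#                ≈⟨ +-identityʳ _ ⟩
    sum (w a b)                     ≡⟨ ∑≡sum m _ ⟨
    Λmat R w a b                    ∎

  Pf-cong : ∀ n {A B : Fin n → Fin n → Carrier} → (∀ i j → A i j ≈ B i j) → Pf R n A ≈ Pf R n B
  Pf-cong zero          _   = refl
  Pf-cong (suc zero)    _   = refl
  Pf-cong (suc (suc n)) A≈B = ∑-cong (suc n) λ j →
    *-cong (*-congˡ {sgn R (Fin.toℕ j)} (A≈B Fin.zero (Fin.suc j)))
           (Pf-cong n (λ x y → A≈B (Fin.suc (punchIn j x)) (Fin.suc (punchIn j y))))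

  𝒫-cong : ∀ n p (w v : Coord R (suc n)) →
           (∀ a b → Λmat R w a b ≈ Λmat R v a b) → 𝒫 R n p w ≈ 𝒫 R n p v
  𝒫-cong n p w v Λw≈Λv = *-congˡ (Pf-cong n (λ i j → Λw≈Λv (punchIn p i) (punchIn p j)))

proposition6p10 : ∀ {c ℓ} (R : CommutativeRing c ℓ) (n : ℕ) (p : Fin (suc n))
    (w w₀ : Coord R (suc n)) → IsAlt R w → InW₀ R w₀ →
    CommutativeRing._≈_ R (𝒫 R n p (_⊕_ R w w₀)) (𝒫 R n p w)
proposition6p10 R n p w w₀ _ w₀∈W₀ =
  𝒫-cong R n p (_⊕_ R w w₀) w (Λmat-⊕-InW₀ R w w₀ w₀∈W₀)
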